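{- Let $\Gamma=(V,E)$ be a finite connected unweighted graph in which every vertex has positive degree, and let $\Gamma'=(V',E')$ be the unweighted graph obtained by attaching a new vertex $i'\notin V$ and a new edge $e'=\{i,i'\}$ to some vertex $i\in V$, so that $V'=V\,\dot\cup\,\{i'\}$ and $E'=E\,\dot\cup\,\{e'\}$. Then $\mathcal{S}(\Gamma)\le\mathcal{S}(\Gamma')$.
   Context: An unweighted graph is one whose adjacency matrix $(a_{ij})$ has entries in $\{0,1\}$; the degree of $j$ is $\deg(j)=\sum_i a_{ij}$. The surface area of a graph with vertex set $V$ is $\mathcal{S}(\Gamma)=\sum_{j\in V}1/\deg(j)$. -}

module Defs where

open import Data.Bool using (Bool; true; false; if_then_else_)
open import Data.Nat using (ℕ; zero; suc)
open import Data.Fin using (Fin; zero; suc; _≟_)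
open import Data.Rational using (ℚ; 0ℚ; _/_; _+_)
import Data.Integer as ℤ
import Data.Nat as ℕ
open import Relation.Nullary.Decidable using (⌊_⌋)
open import Relation.Binary.PropositionalEquality using (_≡_)

-- An unweighted graph on vertex set Fin n: adjacency matrix with entries in {0,1}
-- (encoded as Bool: true = 1, false = 0), required to be symmetric.
Adj : ℕ → Set
Adj n = Fin n → Fin n → Bool

Symmetric : ∀ {n} → Adj n → Set
Symmetric {n} a = (i j : Fin n) → a i j ≡ a j i

val : Bool → ℕ
val true  = 1
val false = 0

sumℕ : ∀ {n} → (Fin n → ℕ) → ℕ
sumℕ {zero}  f = 0
sumℕ {suc n} f = f zero ℕ.+ sumℕ (λ k → f (suc k))

sumℚ : ∀ {n} → (Fin n → ℚ) → ℚ
sumℚ {zero}  f = 0ℚ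
sumℚ {suc n} f = f zero + sumℚ (λ k → f (suc k))

deg : ∀ {n} → Adj n → Fin n → ℕ
deg a j = sumℕ (λ i → val (a i j))

-- 1/d for d ≥ 1 (the value at d = 0 is an irrelevant convention; it is only
-- used under the hypothesis that all degrees are positive)
inv : ℕ → ℚ
inv zero    = 0ℚ
inv (suc d) = ℤ.+ 1 / suc d

surfaceArea : ∀ {n} → Adj n → ℚ
surfaceArea a = sumℚ (λ j → inv (deg a j))

data Reach {n} (a : Adj n) : Fin n → Fin n → Set where
  here : ∀ {i} → Reach a i i
  step : ∀ {i j k} → a j k ≡ true → Reach a i j → Reach a i k

Connected : ∀ {n} → Adj n → Set
Connected {n} a = (i j : Fin n) → Reach a i j

-- Attach a new pendant vertex i' (= zero in Fin (suc n)) to vertex i;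
-- old vertex v becomes suc v. New edge e' = {i, i'}.
attach : ∀ {n} → Adj n → Fin n → Adj (suc n)
attach a i zero    zero    = false
attach a i zero    (suc k) = ⌊ k ≟ i ⌋
attach a i (suc j) zero    = ⌊ j ≟ i ⌋
attach a i (suc j) (suc k) = a j k

{-# OPTIONS --safe #-}
-- Attaching the pendant vertex i' adds a term 1/deg(i') = 1 to the surface area and changes
-- only one other term, 1/deg(i) ↦ 1/(deg(i) + 1); the loss 1/deg(i) − 1/(deg(i) + 1) there
-- is at most 1.
module Submission where

open import Defs
open import Algebra.Bundles using (Monoid)
import Algebra.Properties.CommutativeMonoid.Sum as CommutativeMonoidSum
import Algebra.Properties.Monoid.Sum as MonoidSum
open import Data.Bool using (Bool; true; false)
import Data.Integer as ℤ
open import Data.Fin using (Fin; zero; suc; _≟_)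
open import Data.Nat using (ℕ; zero; suc; _<_; z≤n; s≤s)
import Data.Nat as ℕ
import Data.Nat.Properties as ℕₚ
open import Data.Nat.Coprimality using (1-coprimeTo)
open import Data.Rational using (ℚ; 0ℚ; 1ℚ; _+_; _≤_; mkℚ; *≤*)
import Data.Rational.Properties as ℚ
open import Relation.Nullary.Decidable using (⌊_⌋; yes; no)
open import Relation.Binary.PropositionalEquality using (_≡_; refl; sym; trans; cong; cong₂; module ≡-Reasoning)

⌊suc≟suc⌋ : ∀ {n} (k i : Fin n) → ⌊ suc k ≟ suc i ⌋ ≡ ⌊ k ≟ i ⌋
⌊suc≟suc⌋ k i with k ≟ i
... | yes _ = refl
... | no _  = refl

module _ {c ℓ} (M : Monoid c ℓ) where
  open Monoid M using (Carrier; _≈_; _∙_; ε; setoid; ∙-cong; ∙-congˡ; identityˡ; identityʳ)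
  open MonoidSum M using (sum; sum-cong-≋; sum-cong-≗; sum-replicate-zero)

  sum-select : (g : Bool → Carrier) → g false ≈ ε →
               ∀ {n} (i : Fin n) → sum (λ k → g ⌊ k ≟ i ⌋) ≈ g true
  sum-select g g-false≈ε {suc n} zero = begin
    g true ∙ sum {n} (λ _ → g false) ≈⟨ ∙-congˡ (sum-cong-≋ {n} (λ _ → g-false≈ε)) ⟩
    g true ∙ sum {n} (λ _ → ε)       ≈⟨ ∙-congˡ (sum-replicate-zero n) ⟩
    g true ∙ ε                       ≈⟨ identityʳ (g true) ⟩
    g true                           ∎
    where open import Relation.Binary.Reasoning.Setoid setoid
  sum-select g g-false≈ε {suc n} (suc i) = begin
    g false ∙ sum (λ k → g ⌊ suc k ≟ suc i ⌋) ≡⟨ cong (g false ∙_) (sum-cong-≗ (λ k → cong g (⌊suc≟suc⌋ k i))) ⟩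
    g false ∙ sum (λ k → g ⌊ k ≟ i ⌋)         ≈⟨ ∙-cong g-false≈ε (sum-select g g-false≈ε i) ⟩
    ε ∙ g true                                 ≈⟨ identityˡ (g true) ⟩
    g true                                     ∎
    where open import Relation.Binary.Reasoning.Setoid setoid

module ℕSum = CommutativeMonoidSum ℕₚ.+-0-commutativeMonoid
module ℚSum = CommutativeMonoidSum ℚ.+-0-commutativeMonoid

sumℕ≡sum : ∀ {n} (f : Fin n → ℕ) → sumℕ f ≡ ℕSum.sum f
sumℕ≡sum {zero}  f = refl
sumℕ≡sum {suc n} f = cong (f zero ℕ.+_) (sumℕ≡sum (λ k → f (suc k)))

sumℚ≡sum : ∀ {n} (f : Fin n → ℚ) → sumℚ f ≡ ℚSum.sum f
sumℚ≡sum {zero}  f = refl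
sumℚ≡sum {suc n} f = cong (f zero +_) (sumℚ≡sum (λ k → f (suc k)))

sumℚ-distrib-+ : ∀ {n} (f g : Fin n → ℚ) → sumℚ (λ k → f k + g k) ≡ sumℚ f + sumℚ g
sumℚ-distrib-+ f g = begin
  sumℚ (λ k → f k + g k)        ≡⟨ sumℚ≡sum (λ k → f k + g k) ⟩
  ℚSum.sum (λ k → f k + g k)    ≡⟨ ℚSum.∑-distrib-+ f g ⟩
  ℚSum.sum f + ℚSum.sum g       ≡⟨ sym (cong₂ _+_ (sumℚ≡sum f) (sumℚ≡sum g)) ⟩
  sumℚ f + sumℚ g               ∎
  where open ≡-Reasoning

sumℚ-mono-≤ : ∀ {n} {f g : Fin n → ℚ} → (∀ k → f k ≤ g k) → sumℚ f ≤ sumℚ g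
sumℚ-mono-≤ {zero}  f≤g = ℚ.≤-refl
sumℚ-mono-≤ {suc n} f≤g = ℚ.+-mono-≤ (f≤g zero) (sumℚ-mono-≤ (λ k → f≤g (suc k)))

indicator : Bool → ℚ
indicator true  = 1ℚ
indicator false = 0ℚ

inv-suc : ∀ d → inv (suc d) ≡ mkℚ (ℤ.+ 1) d (1-coprimeTo (suc d))
inv-suc d = ℚ.normalize-coprime (1-coprimeTo (suc d))

inv≤1 : ∀ d → inv d ≤ 1ℚ
inv≤1 zero    = *≤* (ℤ.+≤+ z≤n)
inv≤1 (suc d) rewrite inv-suc d = *≤* (ℤ.+≤+ (s≤s z≤n))

0≤inv : ∀ d → 0ℚ ≤ inv d
0≤inv zero    = ℚ.≤-refl
0≤inv (suc d) rewrite inv-suc d = *≤* (ℤ.+≤+ z≤n)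

inv≤indicator+inv : ∀ b d → inv d ≤ indicator b + inv (val b ℕ.+ d)
inv≤indicator+inv false d = ℚ.≤-reflexive (sym (ℚ.+-identityˡ (inv d)))
inv≤indicator+inv true  d = begin
  inv d                ≤⟨ inv≤1 d ⟩
  1ℚ                   ≡⟨ sym (ℚ.+-identityʳ 1ℚ) ⟩
  1ℚ + 0ℚ              ≤⟨ ℚ.+-monoʳ-≤ 1ℚ (0≤inv (suc d)) ⟩
  1ℚ + inv (suc d)     ∎
  where open ℚ.≤-Reasoning

deg-attach-new : ∀ {n} (a : Adj n) (i : Fin n) → deg (attach a i) zero ≡ 1
deg-attach-new a i = begin
  sumℕ (λ k → val ⌊ k ≟ i ⌋)     ≡⟨ sumℕ≡sum (λ k → val ⌊ k ≟ i ⌋) ⟩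
  ℕSum.sum (λ k → val ⌊ k ≟ i ⌋) ≡⟨ sum-select ℕₚ.+-0-monoid val refl i ⟩
  1                               ∎
  where open ≡-Reasoning

sumℚ-indicator : ∀ {n} (i : Fin n) → sumℚ (λ k → indicator ⌊ k ≟ i ⌋) ≡ 1ℚ
sumℚ-indicator i = trans (sumℚ≡sum (λ k → indicator ⌊ k ≟ i ⌋)) (sum-select ℚ.+-0-monoid indicator refl i)

surfaceArea-≤-attach : ∀ {n} (a : Adj n) (i : Fin n) → surfaceArea a ≤ surfaceArea (attach a i)
surfaceArea-≤-attach a i = begin
  sumℚ (λ k → inv (deg a k))
    -- deg a′ (suc k) reduces to val (δ k) + deg a k
    ≤⟨ sumℚ-mono-≤ (λ k → inv≤indicator+inv (δ k) (deg a k)) ⟩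
  sumℚ (λ k → indicator (δ k) + inv (deg a′ (suc k)))
    ≡⟨ sumℚ-distrib-+ (λ k → indicator (δ k)) (λ k → inv (deg a′ (suc k))) ⟩
  sumℚ (λ k → indicator (δ k)) + sumℚ (λ k → inv (deg a′ (suc k)))
    ≡⟨ cong (_+ sumℚ (λ k → inv (deg a′ (suc k))))
            (trans (sumℚ-indicator i) (cong inv (sym (deg-attach-new a i)))) ⟩
  surfaceArea a′ ∎
  where
  open ℚ.≤-Reasoning
  a′ : Adj (suc _)
  a′ = attach a i
  δ : Fin _ → Bool
  δ k = ⌊ k ≟ i ⌋

mainTheorem5 : (n : ℕ) (a : Adj n) → Symmetric a → Connected a →
               ((j : Fin n) → 0 < deg a j) → (i : Fin n) →
               surfaceArea a ≤ surfaceArea (attach a i)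
mainTheorem5 n a _ _ _ i = surfaceArea-≤-attach a i
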